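{- For every $n\ge 3$, the number of alternating permutations $\sigma\in A_n$ satisfying $\sigma_2>\max\{\sigma_1,\sigma_3\}+1$ equals $n!$ times the coefficient of $x^n$ in $$\sec x+\tan x-\int_0^x t(\sec t+\tan t)\,dt.$$
   Context: A permutation $\sigma$ of $\{1,\dots,n\}$ is alternating if $\sigma_1<\sigma_2>\sigma_3<\sigma_4>\cdots$; $A_n$ is the set of such permutations. -}

module Defs where

open import Data.Bool using (Bool; true; false; if_then_else_)
open import Data.Nat as ℕ using (ℕ; zero; suc; _<_; _⊔_; _!; _/_)
open import Data.Nat.Properties using (_!≢0)
open import Data.Integer using (+_)
open import Data.Rational as ℚ using (ℚ; 0ℚ; 1ℚ; -_; _+_; _*_)
open import Data.List using (List; []; _∷_; map; upTo; zipWith; foldr)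
open import Data.List.Relation.Binary.Permutation.Propositional using (_↭_)
open import Data.Unit using (⊤)
open import Data.Product using (_×_)

oneTo : ℕ → List ℕ
oneTo n = map suc (upTo n)

IsPerm : ℕ → List ℕ → Set
IsPerm n σ = σ ↭ oneTo n

mutual
  AltUp : List ℕ → Set
  AltUp []            = ⊤
  AltUp (a ∷ [])      = ⊤
  AltUp (a ∷ b ∷ r)   = (a < b) × AltDown (b ∷ r)

  AltDown : List ℕ → Set
  AltDown []          = ⊤
  AltDown (a ∷ [])    = ⊤
  AltDown (a ∷ b ∷ r) = (b < a) × AltUp (b ∷ r)

Alternating : ℕ → List ℕ → Set
Alternating n σ = IsPerm n σ × AltUp σ

PeakCond : List ℕ → Set
PeakCond (a ∷ b ∷ c ∷ r) = suc (a ⊔ c) < b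
PeakCond _               = Data.Empty.⊥
  where import Data.Empty

Good : ℕ → List ℕ → Set
Good n σ = Alternating n σ × PeakCond σ

PS : Set
PS = ℕ → ℚ

sumℚ : List ℚ → ℚ
sumℚ = foldr _+_ 0ℚ

_⊕_ : PS → PS → PS
(f ⊕ g) n = f n + g n

_⊖_ : PS → PS → PS
(f ⊖ g) n = f n + (- g n)

_⊛_ : PS → PS → PS
(f ⊛ g) n = sumℚ (map (λ k → f k * g (n ℕ.∸ k)) (upTo (suc n)))

-- multiplicative inverse of a series with constant term 1:
-- g₀ = 1, gₙ = - Σ_{k=1}^{n} f_k g_{n-k}.  invRev f n = [gₙ, …, g₀]
invRev : PS → ℕ → List ℚ
invRev f zero    = 1ℚ ∷ []
invRev f (suc n) =
  (- sumℚ (zipWith _*_ (map f (oneTo (suc n))) (invRev f n))) ∷ invRev f n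

headℚ : List ℚ → ℚ
headℚ []      = 0ℚ
headℚ (x ∷ _) = x

inv₁ : PS → PS
inv₁ f n = headℚ (invRev f n)

xmul : PS → PS
xmul f zero    = 0ℚ
xmul f (suc n) = f n

integ : PS → PS
integ f zero    = 0ℚ
integ f (suc n) = f n * (+ 1 ℚ./ suc n)

isEven : ℕ → Bool
isEven zero          = true
isEven (suc zero)    = false
isEven (suc (suc n)) = isEven n

sgn : ℕ → ℚ
sgn zero    = 1ℚ
sgn (suc k) = - sgn k

invFact : ℕ → ℚ
invFact n = (+ 1 ℚ./ (n !)) {{n !≢0}}

cosPS : PS
cosPS n = if isEven n then sgn (n / 2) * invFact n else 0ℚ

sinPS : PS
sinPS n = if isEven n then 0ℚ else sgn (n / 2) * invFact n

secPS : PS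
secPS = inv₁ cosPS      -- cos has constant term 1

tanPS : PS
tanPS = sinPS ⊛ secPS

targetPS : PS
targetPS = (secPS ⊕ tanPS) ⊖ integ (xmul (secPS ⊕ tanPS))

ℕtoℚ : ℕ → ℚ
ℕtoℚ n = + n ℚ./ 1

{-# OPTIONS --safe #-}

-- Encode σ ∈ Aₙ by a = σ₁, the rank b of σ₂ among σ₂, …, σₙ, and the pattern τ of σ₃ … σₙ, an up-down
-- permutation of {1, …, n − 2}. Then σ is alternating iff a ≤ b and τ₁ < b, and it satisfies the peak
-- condition iff moreover a < b and τ₁ + 1 < b. With U(b) the number of such τ having τ₁ < b, this gives
-- |Aₙ| = Σ_{b<n} b U(b) and #good = Σ_{b<n} (b − 1) U(b − 1), hence |Aₙ| − #good = (n − 1) |Aₙ₋₂|.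
-- André's theorem |Aₖ| = k! [xᵏ](sec x + tan x) then gives the claim, since
-- n! [xⁿ] ∫₀ˣ t (sec t + tan t) dt = (n − 1) (n − 2)! [xⁿ⁻²](sec x + tan x).
--
-- André's theorem goes through the Entringer numbers E(m, a), the number of up-down permutations of
-- {1, …, m} with first entry at most a. Deleting the first entry yields the boustrophedon recurrence
-- E(m + 1, a + 1) = E(m + 1, a) + E(m, m − a). The coefficients of (cos x + sin y) / cos (x + y) satisfy it by
-- Pascal's rule and cos′ = − sin, sin′ = cos, with E(m + 1, 0) = 0 coming from sec · cos = 1, and they give
-- E(m, m) = m! [xᵐ](sec x + tan x).

module Submission where

open import Algebra.Bundles using (CommutativeSemiring; CommutativeRing)
open import Data.Nat as ℕ using (ℕ; zero; suc; _∸_; _≤_; _<_; s≤s; z≤n; _!; NonZero; _<?_; _≤?_; _⊔_; pred)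
open import Data.Nat.Properties using (_!≢0)
import Data.Nat.Properties as ℕP

module FiniteSum {c ℓ} (R : CommutativeSemiring c ℓ) where

  open CommutativeSemiring R renaming (refl to ≈-refl; sym to ≈-sym; trans to ≈-trans)
  open import Algebra.Properties.CommutativeSemigroup +-commutativeSemigroup using (interchange)

  ∑ : ℕ → (ℕ → Carrier) → Carrier
  ∑ zero    f = 0#
  ∑ (suc n) f = ∑ n f + f n

  ∑-cong : ∀ n {f g : ℕ → Carrier} → (∀ i → i < n → f i ≈ g i) → ∑ n f ≈ ∑ n g
  ∑-cong zero    _   = ≈-refl
  ∑-cong (suc n) f≈g = +-cong (∑-cong n (λ i i<n → f≈g i (ℕP.m<n⇒m<1+n i<n))) (f≈g n ℕP.≤-refl)

  ∑-zero : ∀ n {f : ℕ → Carrier} → (∀ i → i < n → f i ≈ 0#) → ∑ n f ≈ 0#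
  ∑-zero n f≈0 = ≈-trans (∑-cong n f≈0) (∑-0# n)
    where
    ∑-0# : ∀ n → ∑ n (λ _ → 0#) ≈ 0#
    ∑-0# zero    = ≈-refl
    ∑-0# (suc n) = ≈-trans (+-congʳ (∑-0# n)) (+-identityˡ 0#)

  ∑-distrib-+ : ∀ n (f g : ℕ → Carrier) → ∑ n (λ i → f i + g i) ≈ ∑ n f + ∑ n g
  ∑-distrib-+ zero    f g = ≈-sym (+-identityˡ 0#)
  ∑-distrib-+ (suc n) f g = ≈-trans (+-congʳ (∑-distrib-+ n f g)) (interchange _ _ _ _)

  ∑-distribˡ-* : ∀ n a (f : ℕ → Carrier) → a * ∑ n f ≈ ∑ n (λ i → a * f i)
  ∑-distribˡ-* zero    a f = zeroʳ a
  ∑-distribˡ-* (suc n) a f = ≈-trans (distribˡ a (∑ n f) (f n)) (+-congʳ (∑-distribˡ-* n a f))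

  ∑-head : ∀ n (f : ℕ → Carrier) → ∑ (suc n) f ≈ f 0 + ∑ n (λ i → f (suc i))
  ∑-head zero    f = ≈-trans (+-identityˡ (f 0)) (≈-sym (+-identityʳ (f 0)))
  ∑-head (suc n) f = ≈-trans (+-congʳ (∑-head n f)) (+-assoc (f 0) _ _)

  ∑-comm : ∀ m n (f : ℕ → ℕ → Carrier) → ∑ m (λ i → ∑ n (f i)) ≈ ∑ n (λ j → ∑ m (λ i → f i j))
  ∑-comm zero    n f = ≈-sym (∑-zero n (λ _ _ → ≈-refl))
  ∑-comm (suc m) n f = ≈-trans (+-congʳ (∑-comm m n f)) (≈-sym (∑-distrib-+ n _ (f m)))

open import Defs
open import Data.Bool using (if_then_else_)
open import Data.Bool.Properties using (if-float; if-cong-then; if-cong-else)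
open import Data.Integer as ℤ using (+_)
import Data.Integer.Properties as ℤP
open import Data.List using (List; []; _∷_; map; _++_; filter; length; upTo; downFrom; applyUpTo; zipWith)
import Data.List.Properties as ListP
open import Data.List.Membership.Propositional using (_∈_)
import Data.List.Membership.Propositional.Properties as ∈P
open import Data.List.Membership.Propositional.Properties.WithK using (unique∧set⇒bag)
open import Data.List.Relation.Binary.BagAndSetEquality using (∼bag⇒↭)
open import Data.List.Relation.Binary.Permutation.Propositional using (↭-sym; ↭⇒↭ₛ)
import Data.List.Relation.Binary.Permutation.Propositional.Properties as ↭P
import Data.List.Relation.Binary.Permutation.Setoid.Properties as ↭ₛP
open import Data.List.Relation.Unary.All as All using (All; []; _∷_)
import Data.List.Relation.Unary.All.Properties as AllP
open import Data.List.Relation.Unary.AllPairs using ([]; _∷_)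
open import Data.List.Relation.Unary.Any using (here; there)
open import Data.List.Relation.Unary.Unique.Propositional using (Unique)
import Data.List.Relation.Unary.Unique.Propositional.Properties as UniqueP
open import Data.Nat.Combinatorics using (_C_; nCk≡n!/k![n-k]!; k![n∸k]!∣n!; nCk+nC[k+1]≡[n+1]C[k+1])
import Data.Nat.Coprimality as Coprime
open import Data.Nat.DivMod using (m/n*n≡m; m/n≡1+[m∸n]/n)
open import Data.Product using (Σ; ∃; _×_; _,_; proj₁; proj₂)
open import Data.Product.Function.NonDependent.Propositional using (_×-⇔_)
open import Data.Rational as ℚ using (ℚ; 0ℚ; 1ℚ; -_; _+_; _-_; _*_)
import Data.Rational.Properties as ℚP
open import Data.Rational.Solver using (module +-*-Solver)
import Data.Rational.Unnormalised as ℚᵘ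
import Data.Rational.Unnormalised.Properties as ℚᵘP
open import Data.Sum using (inj₁; inj₂)
open import Data.Unit using (⊤; tt)
open import Function using (_∘_)
open import Function.Bundles using (_⇔_; mk⇔; Equivalence)
open import Function.Construct.Composition using (_⇔-∘_)
open import Function.Construct.Identity using (⇔-id)
open import Function.Properties.Equivalence using () renaming (sym to ⇔-sym)
open import Level using (0ℓ)
open import Relation.Binary.Definitions using (tri<; tri≈; tri>)
open import Relation.Binary.PropositionalEquality
open import Relation.Nullary using (Dec; yes; no; ¬_; contradiction)
open import Relation.Nullary.Decidable using (_×-dec_)
open import Relation.Unary using (Pred; Decidable)

module ℕ∑ = FiniteSum ℕP.+-*-commutativeSemiring
module ℚ∑ = FiniteSum (CommutativeRing.commutativeSemiring ℚP.+-*-commutativeRing)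

toℚᵘ-ℕtoℚ : ∀ n → ℚ.toℚᵘ (ℕtoℚ n) ≡ ℚᵘ.mkℚᵘ (+ n) 0
toℚᵘ-ℕtoℚ n = cong ℚ.toℚᵘ (ℚP.normalize-coprime (Coprime.sym (Coprime.1-coprimeTo n)))

ℕtoℚ-+ : ∀ m n → ℕtoℚ (m ℕ.+ n) ≡ ℕtoℚ m + ℕtoℚ n
ℕtoℚ-+ m n = ℚP.toℚᵘ-injective (begin
  ℚ.toℚᵘ (ℕtoℚ (m ℕ.+ n))                    ≡⟨ toℚᵘ-ℕtoℚ (m ℕ.+ n) ⟩
  ℚᵘ.mkℚᵘ (+ (m ℕ.+ n)) 0                    ≈⟨ ℚᵘ.*≡* (cong (ℤ._* + 1) (cong₂ ℤ._+_ (sym (ℤP.*-identityʳ (+ m))) (sym (ℤP.*-identityʳ (+ n))))) ⟩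
  ℚᵘ.mkℚᵘ (+ m) 0 ℚᵘ.+ ℚᵘ.mkℚᵘ (+ n) 0        ≡⟨ cong₂ ℚᵘ._+_ (toℚᵘ-ℕtoℚ m) (toℚᵘ-ℕtoℚ n) ⟨
  ℚ.toℚᵘ (ℕtoℚ m) ℚᵘ.+ ℚ.toℚᵘ (ℕtoℚ n)      ≈⟨ ℚP.toℚᵘ-homo-+ (ℕtoℚ m) (ℕtoℚ n) ⟨
  ℚ.toℚᵘ (ℕtoℚ m + ℕtoℚ n)                  ∎)
  where open ℚᵘP.≃-Reasoning

ℕtoℚ-* : ∀ m n → ℕtoℚ (m ℕ.* n) ≡ ℕtoℚ m * ℕtoℚ n
ℕtoℚ-* m n = ℚP.toℚᵘ-injective (begin
  ℚ.toℚᵘ (ℕtoℚ (m ℕ.* n))                    ≡⟨ toℚᵘ-ℕtoℚ (m ℕ.* n) ⟩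
  ℚᵘ.mkℚᵘ (+ (m ℕ.* n)) 0                    ≈⟨ ℚᵘ.*≡* (cong (ℤ._* + 1) (ℤP.pos-* m n)) ⟩
  ℚᵘ.mkℚᵘ (+ m) 0 ℚᵘ.* ℚᵘ.mkℚᵘ (+ n) 0        ≡⟨ cong₂ ℚᵘ._*_ (toℚᵘ-ℕtoℚ m) (toℚᵘ-ℕtoℚ n) ⟨
  ℚ.toℚᵘ (ℕtoℚ m) ℚᵘ.* ℚ.toℚᵘ (ℕtoℚ n)      ≈⟨ ℚP.toℚᵘ-homo-* (ℕtoℚ m) (ℕtoℚ n) ⟨
  ℚ.toℚᵘ (ℕtoℚ m * ℕtoℚ n)                  ∎)
  where open ℚᵘP.≃-Reasoning

ℕtoℚ-∑ : ∀ n f → ℕtoℚ (ℕ∑.∑ n f) ≡ ℚ∑.∑ n (ℕtoℚ ∘ f)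
ℕtoℚ-∑ zero    f = refl
ℕtoℚ-∑ (suc n) f = trans (ℕtoℚ-+ (ℕ∑.∑ n f) (f n)) (cong (_+ ℕtoℚ (f n)) (ℕtoℚ-∑ n f))

ℕtoℚ-*-inverse : ∀ n .{{_ : NonZero n}} → ℕtoℚ n * (+ 1 ℚ./ n) ≡ 1ℚ
ℕtoℚ-*-inverse (suc n) = ℚP.toℚᵘ-injective toℚᵘ[n*1/n]≃1
  where
  toℚᵘ-1/[1+n] : ℚ.toℚᵘ (+ 1 ℚ./ suc n) ≡ ℚᵘ.mkℚᵘ (+ 1) n
  toℚᵘ-1/[1+n] = cong ℚ.toℚᵘ (ℚP.normalize-coprime (Coprime.1-coprimeTo (suc n)))
  cross-multiplied : + (suc n ℕ.* 1) ℤ.* + 1 ≡ + 1 ℤ.* + suc (n ℕ.+ 0)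
  cross-multiplied = begin
    + (suc n ℕ.* 1) ℤ.* + 1   ≡⟨ ℤP.*-identityʳ _ ⟩
    + (suc n ℕ.* 1)           ≡⟨ cong +_ (ℕP.*-identityʳ (suc n)) ⟩
    + suc n                   ≡⟨ cong (λ k → + suc k) (ℕP.+-identityʳ n) ⟨
    + suc (n ℕ.+ 0)           ≡⟨ ℤP.*-identityˡ _ ⟨
    + 1 ℤ.* + suc (n ℕ.+ 0)   ∎
    where open ≡-Reasoning
  toℚᵘ[n*1/n]≃1 : ℚ.toℚᵘ (ℕtoℚ (suc n) * (+ 1 ℚ./ suc n)) ℚᵘ.≃ ℚᵘ.1ℚᵘ
  toℚᵘ[n*1/n]≃1 = begin
    ℚ.toℚᵘ (ℕtoℚ (suc n) * (+ 1 ℚ./ suc n))             ≈⟨ ℚP.toℚᵘ-homo-* (ℕtoℚ (suc n)) (+ 1 ℚ./ suc n) ⟩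
    ℚ.toℚᵘ (ℕtoℚ (suc n)) ℚᵘ.* ℚ.toℚᵘ (+ 1 ℚ./ suc n)   ≡⟨ cong₂ ℚᵘ._*_ (toℚᵘ-ℕtoℚ (suc n)) toℚᵘ-1/[1+n] ⟩
    ℚᵘ.mkℚᵘ (+ suc n) 0 ℚᵘ.* ℚᵘ.mkℚᵘ (+ 1) n            ≈⟨ ℚᵘ.*≡* cross-multiplied ⟩
    ℚᵘ.1ℚᵘ                                             ∎
    where open ℚᵘP.≃-Reasoning

-- Power series

mutual
  cosDeriv : ℕ → ℚ
  cosDeriv zero    = 1ℚ
  cosDeriv (suc i) = - sinDeriv i

  sinDeriv : ℕ → ℚ
  sinDeriv zero    = 0ℚ
  sinDeriv (suc i) = cosDeriv i

[2+n]/2≡1+n/2 : ∀ n → suc (suc n) ℕ./ 2 ≡ suc (n ℕ./ 2)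
[2+n]/2≡1+n/2 n = m/n≡1+[m∸n]/n {suc (suc n)} {2} (s≤s (s≤s z≤n))

cosDeriv-parity : ∀ i → cosDeriv i ≡ (if isEven i then sgn (i ℕ./ 2) else 0ℚ)
sinDeriv-parity : ∀ i → sinDeriv i ≡ (if isEven i then 0ℚ else sgn (i ℕ./ 2))
cosDeriv-parity zero          = refl
cosDeriv-parity (suc zero)    = refl
cosDeriv-parity (suc (suc i)) = begin
  - cosDeriv i                                            ≡⟨ cong -_ (cosDeriv-parity i) ⟩
  - (if isEven i then sgn (i ℕ./ 2) else 0ℚ)               ≡⟨ if-float -_ (isEven i) ⟩
  (if isEven i then sgn (suc (i ℕ./ 2)) else 0ℚ)          ≡⟨ cong (λ k → if isEven i then sgn k else 0ℚ) ([2+n]/2≡1+n/2 i) ⟨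
  (if isEven i then sgn (suc (suc i) ℕ./ 2) else 0ℚ)      ∎
  where open ≡-Reasoning
sinDeriv-parity zero          = refl
sinDeriv-parity (suc zero)    = refl
sinDeriv-parity (suc (suc i)) = begin
  - sinDeriv i                                            ≡⟨ cong -_ (sinDeriv-parity i) ⟩
  - (if isEven i then 0ℚ else sgn (i ℕ./ 2))               ≡⟨ if-float -_ (isEven i) ⟩
  (if isEven i then 0ℚ else sgn (suc (i ℕ./ 2)))          ≡⟨ cong (λ k → if isEven i then 0ℚ else sgn k) ([2+n]/2≡1+n/2 i) ⟨
  (if isEven i then 0ℚ else sgn (suc (suc i) ℕ./ 2))      ∎
  where open ≡-Reasoning

cosPS≡cosDeriv*invFact : ∀ i → cosPS i ≡ cosDeriv i * invFact i
cosPS≡cosDeriv*invFact i = begin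
  (if isEven i then sgn (i ℕ./ 2) * invFact i else 0ℚ)            ≡⟨ if-cong-else (isEven i) (ℚP.*-zeroˡ (invFact i)) ⟨
  (if isEven i then sgn (i ℕ./ 2) * invFact i else 0ℚ * invFact i) ≡⟨ if-float (_* invFact i) (isEven i) ⟨
  (if isEven i then sgn (i ℕ./ 2) else 0ℚ) * invFact i            ≡⟨ cong (_* invFact i) (cosDeriv-parity i) ⟨
  cosDeriv i * invFact i                                         ∎
  where open ≡-Reasoning

sinPS≡sinDeriv*invFact : ∀ i → sinPS i ≡ sinDeriv i * invFact i
sinPS≡sinDeriv*invFact i = begin
  (if isEven i then 0ℚ else sgn (i ℕ./ 2) * invFact i)            ≡⟨ if-cong-then (isEven i) (ℚP.*-zeroˡ (invFact i)) ⟨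
  (if isEven i then 0ℚ * invFact i else sgn (i ℕ./ 2) * invFact i) ≡⟨ if-float (_* invFact i) (isEven i) ⟨
  (if isEven i then 0ℚ else sgn (i ℕ./ 2)) * invFact i            ≡⟨ cong (_* invFact i) (sinDeriv-parity i) ⟨
  sinDeriv i * invFact i                                         ∎
  where open ≡-Reasoning

sumℚ-applyUpTo : ∀ n (f : ℕ → ℚ) → sumℚ (applyUpTo f n) ≡ ℚ∑.∑ n f
sumℚ-applyUpTo zero    f = refl
sumℚ-applyUpTo (suc n) f = trans (cong (_+_ (f 0)) (sumℚ-applyUpTo n (f ∘ suc))) (sym (ℚ∑.∑-head n f))

⊛-∑ : ∀ (f g : PS) n → (f ⊛ g) n ≡ ℚ∑.∑ (suc n) (λ i → f i * g (n ∸ i))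
⊛-∑ f g n = trans (cong sumℚ (ListP.map-upTo term (suc n))) (sumℚ-applyUpTo (suc n) term)
  where term = λ i → f i * g (n ∸ i)

sumℚ-zipWith-* : ∀ n (f g : ℕ → ℚ) →
  sumℚ (zipWith _*_ (applyUpTo f (suc n)) (map g (downFrom (suc n)))) ≡ ℚ∑.∑ (suc n) (λ i → f i * g (n ∸ i))
sumℚ-zipWith-* zero    f g = trans (ℚP.+-identityʳ (f 0 * g 0)) (sym (ℚP.+-identityˡ (f 0 * g 0)))
sumℚ-zipWith-* (suc n) f g =
  trans (cong (_+_ (f 0 * g (suc n))) (sumℚ-zipWith-* n (f ∘ suc) g)) (sym (ℚ∑.∑-head (suc n) _))

invRev≡map-inv₁ : ∀ f n → invRev f n ≡ map (inv₁ f) (downFrom (suc n))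
invRev≡map-inv₁ f zero    = refl
invRev≡map-inv₁ f (suc n) = cong (inv₁ f (suc n) ∷_) (invRev≡map-inv₁ f n)

inv₁-suc : ∀ f n → inv₁ f (suc n) ≡ - ℚ∑.∑ (suc n) (λ i → f (suc i) * inv₁ f (n ∸ i))
inv₁-suc f n = cong -_ (begin
  sumℚ (zipWith _*_ (map f (oneTo (suc n))) (invRev f n))
    ≡⟨ cong₂ (λ xs ys → sumℚ (zipWith _*_ xs ys)) map-oneTo (invRev≡map-inv₁ f n) ⟩
  sumℚ (zipWith _*_ (applyUpTo (f ∘ suc) (suc n)) (map (inv₁ f) (downFrom (suc n))))
    ≡⟨ sumℚ-zipWith-* n (f ∘ suc) (inv₁ f) ⟩
  ℚ∑.∑ (suc n) (λ i → f (suc i) * inv₁ f (n ∸ i)) ∎)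
  where
  open ≡-Reasoning
  map-oneTo : map f (oneTo (suc n)) ≡ applyUpTo (f ∘ suc) (suc n)
  map-oneTo = trans (sym (ListP.map-∘ (upTo (suc n)))) (ListP.map-upTo (f ∘ suc) (suc n))

⊛-inv₁ : ∀ f → f 0 ≡ 1ℚ → ∀ n → (f ⊛ inv₁ f) (suc n) ≡ 0ℚ
⊛-inv₁ f f₀≡1 n = begin
  (f ⊛ inv₁ f) (suc n)                                     ≡⟨ ⊛-∑ f (inv₁ f) (suc n) ⟩
  ℚ∑.∑ (suc (suc n)) (λ i → f i * inv₁ f (suc n ∸ i))      ≡⟨ ℚ∑.∑-head (suc n) _ ⟩
  f 0 * inv₁ f (suc n) + tail                              ≡⟨ cong (λ c → c * inv₁ f (suc n) + tail) f₀≡1 ⟩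
  1ℚ * inv₁ f (suc n) + tail                               ≡⟨ cong (_+ tail) (trans (ℚP.*-identityˡ _) (inv₁-suc f n)) ⟩
  - tail + tail                                            ≡⟨ ℚP.+-inverseˡ tail ⟩
  0ℚ                                                       ∎
  where
  open ≡-Reasoning
  tail = ℚ∑.∑ (suc n) (λ i → f (suc i) * inv₁ f (n ∸ i))

-- n! [xⁿ] f, the n-th derivative at 0 of the function with Taylor coefficients f
deriv : PS → ℕ → ℚ
deriv f n = ℕtoℚ (n !) * f n

binomialConv : ℕ → (ℕ → ℚ) → (ℕ → ℚ) → ℕ → ℚ
binomialConv m a b n = ℚ∑.∑ (suc n) (λ i → ℕtoℚ (m C i) * a i * b (n ∸ i))

nCk*k![n∸k]!≡n! : ∀ {n k} → k ≤ n → (n C k) ℕ.* (k ! ℕ.* (n ∸ k) !) ≡ n !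
nCk*k![n∸k]!≡n! {n} {k} k≤n = trans (cong (ℕ._* (k ! ℕ.* (n ∸ k) !)) (nCk≡n!/k![n-k]! k≤n)) (m/n*n≡m (k![n∸k]!∣n! k≤n))
  where instance _ = ℕP.m*n≢0 (k !) ((n ∸ k) !) {{k !≢0}} {{(n ∸ k) !≢0}}

leibniz : ∀ f g n → deriv (f ⊛ g) n ≡ binomialConv n (deriv f) (deriv g) n
leibniz f g n = begin
  ℕtoℚ (n !) * (f ⊛ g) n                                     ≡⟨ cong (ℕtoℚ (n !) *_) (⊛-∑ f g n) ⟩
  ℕtoℚ (n !) * ℚ∑.∑ (suc n) (λ i → f i * g (n ∸ i))          ≡⟨ ℚ∑.∑-distribˡ-* (suc n) (ℕtoℚ (n !)) _ ⟩
  ℚ∑.∑ (suc n) (λ i → ℕtoℚ (n !) * (f i * g (n ∸ i)))        ≡⟨ ℚ∑.∑-cong (suc n) (λ i i≤n → term i (ℕP.≤-pred i≤n)) ⟩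
  binomialConv n (deriv f) (deriv g) n                       ∎
  where
  open ≡-Reasoning
  open +-*-Solver
  term : ∀ i → i ≤ n → ℕtoℚ (n !) * (f i * g (n ∸ i)) ≡ ℕtoℚ (n C i) * deriv f i * deriv g (n ∸ i)
  term i i≤n = begin
    ℕtoℚ (n !) * (f i * g (n ∸ i))
      ≡⟨ cong (λ c → ℕtoℚ c * (f i * g (n ∸ i))) (nCk*k![n∸k]!≡n! i≤n) ⟨
    ℕtoℚ ((n C i) ℕ.* (i ! ℕ.* (n ∸ i) !)) * (f i * g (n ∸ i))
      ≡⟨ cong (_* (f i * g (n ∸ i))) (trans (ℕtoℚ-* (n C i) _) (cong (ℕtoℚ (n C i) *_) (ℕtoℚ-* (i !) ((n ∸ i) !)))) ⟩
    ℕtoℚ (n C i) * (ℕtoℚ (i !) * ℕtoℚ ((n ∸ i) !)) * (f i * g (n ∸ i))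
      ≡⟨ solve 5 (λ c p q x y → c :* (p :* q) :* (x :* y) := c :* (p :* x) :* (q :* y)) refl
               (ℕtoℚ (n C i)) (ℕtoℚ (i !)) (ℕtoℚ ((n ∸ i) !)) (f i) (g (n ∸ i)) ⟩
    ℕtoℚ (n C i) * deriv f i * deriv g (n ∸ i) ∎

binomialConv-cong : ∀ m {a a′ : ℕ → ℚ} b n → (∀ i → a i ≡ a′ i) → binomialConv m a b n ≡ binomialConv m a′ b n
binomialConv-cong m b n a≡a′ = ℚ∑.∑-cong (suc n) (λ i _ → cong (λ x → ℕtoℚ (m C i) * x * b (n ∸ i)) (a≡a′ i))

binomialConv-zero : ∀ a b n → binomialConv 0 a b n ≡ a 0 * b n
binomialConv-zero a b n = begin
  binomialConv 0 a b n                                  ≡⟨ ℚ∑.∑-head n _ ⟩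
  1ℚ * a 0 * b n + ℚ∑.∑ n (λ i → 0ℚ * a (suc i) * b (n ∸ suc i))
    ≡⟨ cong₂ _+_ (cong (_* b n) (ℚP.*-identityˡ (a 0)))
                 (ℚ∑.∑-zero n (λ i _ → trans (cong (_* b (n ∸ suc i)) (ℚP.*-zeroˡ (a (suc i)))) (ℚP.*-zeroˡ (b (n ∸ suc i))))) ⟩
  a 0 * b n + 0ℚ                                        ≡⟨ ℚP.+-identityʳ (a 0 * b n) ⟩
  a 0 * b n                                             ∎
  where open ≡-Reasoning

binomialConv-neg : ∀ m a b n → binomialConv m (λ i → - a i) b n ≡ - binomialConv m a b n
binomialConv-neg m a b n = trans (ℚ∑.∑-cong (suc n) (λ i _ → term i)) (sym (∑-neg (suc n) _))
  where
  open +-*-Solver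
  term : ∀ i → ℕtoℚ (m C i) * - a i * b (n ∸ i) ≡ - (ℕtoℚ (m C i) * a i * b (n ∸ i))
  term i = solve 3 (λ c x y → c :* (:- x) :* y := :- (c :* x :* y)) refl (ℕtoℚ (m C i)) (a i) (b (n ∸ i))
  ∑-neg : ∀ n f → - ℚ∑.∑ n f ≡ ℚ∑.∑ n (λ i → - f i)
  ∑-neg zero    f = refl
  ∑-neg (suc n) f = trans (ℚP.neg-distrib-+ (ℚ∑.∑ n f) (f n)) (cong (_+ - f n) (∑-neg n f))

binomialConv-pascal : ∀ m a b n →
  binomialConv (suc m) a b (suc n) ≡ binomialConv m a b (suc n) + binomialConv m (a ∘ suc) b n
binomialConv-pascal m a b n = begin
  binomialConv (suc m) a b (suc n)
    ≡⟨ ℚ∑.∑-head (suc n) _ ⟩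
  a₀b + ℚ∑.∑ (suc n) (λ i → ℕtoℚ (suc m C suc i) * a (suc i) * b (n ∸ i))
    ≡⟨ cong (_+_ a₀b) (ℚ∑.∑-cong (suc n) (λ i _ → term i)) ⟩
  a₀b + ℚ∑.∑ (suc n) (λ i → upper i + lower i)
    ≡⟨ cong (_+_ a₀b) (ℚ∑.∑-distrib-+ (suc n) upper lower) ⟩
  a₀b + (ℚ∑.∑ (suc n) upper + ℚ∑.∑ (suc n) lower)
    ≡⟨ ℚP.+-assoc a₀b _ _ ⟨
  (a₀b + ℚ∑.∑ (suc n) upper) + ℚ∑.∑ (suc n) lower
    ≡⟨ cong (_+ ℚ∑.∑ (suc n) lower) (ℚ∑.∑-head (suc n) _) ⟨
  binomialConv m a b (suc n) + binomialConv m (a ∘ suc) b n ∎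
  where
  open ≡-Reasoning
  open +-*-Solver
  a₀b = 1ℚ * a 0 * b (suc n)
  upper lower : ℕ → ℚ
  upper i = ℕtoℚ (m C suc i) * a (suc i) * b (n ∸ i)
  lower i = ℕtoℚ (m C i) * a (suc i) * b (n ∸ i)
  term : ∀ i → ℕtoℚ (suc m C suc i) * a (suc i) * b (n ∸ i) ≡ upper i + lower i
  term i = trans (cong (λ c → ℕtoℚ c * a (suc i) * b (n ∸ i))
                       (trans (sym (nCk+nC[k+1]≡[n+1]C[k+1] m i)) (ℕP.+-comm (m C i) (m C suc i))))
           (trans (cong (λ c → c * a (suc i) * b (n ∸ i)) (ℕtoℚ-+ (m C suc i) (m C i)))
                  (solve 4 (λ p q x y → (p :+ q) :* x :* y := p :* x :* y :+ q :* x :* y) refl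
                         (ℕtoℚ (m C suc i)) (ℕtoℚ (m C i)) (a (suc i)) (b (n ∸ i))))

f≡a*invFact⇒deriv≡a : ∀ (a : ℕ → ℚ) {f : PS} → (∀ i → f i ≡ a i * invFact i) → ∀ i → deriv f i ≡ a i
f≡a*invFact⇒deriv≡a a {f} f≡a*invFact i = begin
  ℕtoℚ (i !) * f i                     ≡⟨ cong (ℕtoℚ (i !) *_) (f≡a*invFact i) ⟩
  ℕtoℚ (i !) * (a i * invFact i)       ≡⟨ ℚP.*-comm (ℕtoℚ (i !)) _ ⟩
  a i * invFact i * ℕtoℚ (i !)         ≡⟨ ℚP.*-assoc (a i) _ _ ⟩
  a i * (invFact i * ℕtoℚ (i !))       ≡⟨ cong (a i *_) (trans (ℚP.*-comm (invFact i) _) (ℕtoℚ-*-inverse (i !) {{i !≢0}})) ⟩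
  a i * 1ℚ                             ≡⟨ ℚP.*-identityʳ (a i) ⟩
  a i                                  ∎
  where open ≡-Reasoning

deriv-cosPS : ∀ i → deriv cosPS i ≡ cosDeriv i
deriv-cosPS = f≡a*invFact⇒deriv≡a cosDeriv cosPS≡cosDeriv*invFact

deriv-sinPS : ∀ i → deriv sinPS i ≡ sinDeriv i
deriv-sinPS = f≡a*invFact⇒deriv≡a sinDeriv sinPS≡sinDeriv*invFact

-- Entringer numbers

secDeriv : ℕ → ℚ
secDeriv = deriv secPS

-- (n ∸ k)! k! [x^(n ∸ k) y^k] of (cos x + sin y) / cos (x + y), the generating function of the Entringer numbers
entringer : ℕ → ℕ → ℚ
entringer n k = binomialConv (n ∸ k) cosDeriv secDeriv n + binomialConv k sinDeriv secDeriv n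

entringer-suc-suc : ∀ {n k} → k ≤ n → entringer (suc n) (suc k) ≡ entringer (suc n) k + entringer n (n ∸ k)
entringer-suc-suc {n} {k} k≤n = begin
  A + binomialConv (suc k) sinDeriv secDeriv (suc n)     ≡⟨ cong (_+_ A) (binomialConv-pascal k sinDeriv secDeriv n) ⟩
  A + (Y + Z)                                           ≡⟨ solve 4 (λ A X Y Z → A :+ (Y :+ Z) := ((A :+ :- X) :+ Y) :+ (Z :+ X)) refl A X Y Z ⟩
  (A + - X + Y) + (Z + X)                               ≡⟨ cong₂ (λ u v → u + Y + v) cosPart
                                                             (cong (λ j → binomialConv j cosDeriv secDeriv n + X) (ℕP.m∸[m∸n]≡n k≤n)) ⟨
  entringer (suc n) k + entringer n (n ∸ k)             ∎
  where
  open ≡-Reasoning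
  open +-*-Solver
  A = binomialConv (n ∸ k) cosDeriv secDeriv (suc n)
  X = binomialConv (n ∸ k) sinDeriv secDeriv n
  Y = binomialConv k sinDeriv secDeriv (suc n)
  Z = binomialConv k cosDeriv secDeriv n
  cosPart : binomialConv (suc n ∸ k) cosDeriv secDeriv (suc n) ≡ A + - X
  cosPart = begin
    binomialConv (suc n ∸ k) cosDeriv secDeriv (suc n)   ≡⟨ cong (λ j → binomialConv j cosDeriv secDeriv (suc n)) (ℕP.+-∸-assoc 1 k≤n) ⟩
    binomialConv (suc (n ∸ k)) cosDeriv secDeriv (suc n) ≡⟨ binomialConv-pascal (n ∸ k) cosDeriv secDeriv n ⟩
    A + binomialConv (n ∸ k) (λ i → - sinDeriv i) secDeriv n ≡⟨ cong (_+_ A) (binomialConv-neg (n ∸ k) sinDeriv secDeriv n) ⟩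
    A + - X                                              ∎

entringer-suc-zero : ∀ n → entringer (suc n) 0 ≡ 0ℚ
entringer-suc-zero n = begin
  binomialConv (suc n) cosDeriv secDeriv (suc n) + binomialConv 0 sinDeriv secDeriv (suc n)
    ≡⟨ cong₂ _+_ (binomialConv-cong (suc n) secDeriv (suc n) (sym ∘ deriv-cosPS))
                 (binomialConv-zero sinDeriv secDeriv (suc n)) ⟩
  binomialConv (suc n) (deriv cosPS) secDeriv (suc n) + 0ℚ * secDeriv (suc n)
    ≡⟨ cong₂ _+_ (sym (leibniz cosPS secPS (suc n))) (ℚP.*-zeroˡ (secDeriv (suc n))) ⟩
  ℕtoℚ (suc n !) * (cosPS ⊛ secPS) (suc n) + 0ℚ
    ≡⟨ cong (λ x → ℕtoℚ (suc n !) * x + 0ℚ) (⊛-inv₁ cosPS refl n) ⟩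
  ℕtoℚ (suc n !) * 0ℚ + 0ℚ
    ≡⟨ cong (_+ 0ℚ) (ℚP.*-zeroʳ (ℕtoℚ (suc n !))) ⟩
  0ℚ ∎
  where open ≡-Reasoning

entringer-diag : ∀ n → entringer n n ≡ ℕtoℚ (n !) * (secPS n + tanPS n)
entringer-diag n = begin
  binomialConv (n ∸ n) cosDeriv secDeriv n + binomialConv n sinDeriv secDeriv n
    ≡⟨ cong₂ _+_ (trans (cong (λ j → binomialConv j cosDeriv secDeriv n) (ℕP.n∸n≡0 n)) (binomialConv-zero cosDeriv secDeriv n))
                 (binomialConv-cong n secDeriv n (sym ∘ deriv-sinPS)) ⟩
  1ℚ * secDeriv n + binomialConv n (deriv sinPS) secDeriv n
    ≡⟨ cong₂ _+_ (ℚP.*-identityˡ (secDeriv n)) (sym (leibniz sinPS secPS n)) ⟩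
  ℕtoℚ (n !) * secPS n + ℕtoℚ (n !) * tanPS n
    ≡⟨ ℚP.*-distribˡ-+ (ℕtoℚ (n !)) (secPS n) (tanPS n) ⟨
  ℕtoℚ (n !) * (secPS n + tanPS n) ∎
  where open ≡-Reasoning

entringer-suc-∑ : ∀ {m j} → j ≤ suc m → entringer (suc m) j ≡ ℚ∑.∑ j (λ t → entringer m (m ∸ t))
entringer-suc-∑ {m} {zero}  _           = entringer-suc-zero m
entringer-suc-∑ {m} {suc j} (s≤s j≤m) =
  trans (entringer-suc-suc j≤m) (cong (_+ entringer m (m ∸ j)) (entringer-suc-∑ (ℕP.m≤n⇒m≤1+n j≤m)))

-- Permutations of {1, …, n} as lists

punchIn : ℕ → ℕ → ℕ
punchIn a x with x <? a
... | yes _ = x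
... | no  _ = suc x

punchIn-< : ∀ {a x} → x < a → punchIn a x ≡ x
punchIn-< {a} {x} x<a with x <? a
... | yes _   = refl
... | no  x≮a = contradiction x<a x≮a

punchIn-≥ : ∀ {a x} → a ≤ x → punchIn a x ≡ suc x
punchIn-≥ {a} {x} a≤x with x <? a
... | yes x<a = contradiction a≤x (ℕP.<⇒≱ x<a)
... | no  _   = refl

punchIn-≢ : ∀ a x → punchIn a x ≢ a
punchIn-≢ a x with x <? a
... | yes x<a = ℕP.<⇒≢ x<a
... | no  x≮a = λ x+1≡a → x≮a (ℕP.≤-reflexive x+1≡a)

punchIn-mono-< : ∀ a {x y} → x < y → punchIn a x < punchIn a y
punchIn-mono-< a {x} {y} x<y with x <? a | y <? a
... | yes _   | yes _   = x<y
... | yes _   | no  _   = ℕP.m<n⇒m<1+n x<y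
... | no  x≮a | yes y<a = contradiction (ℕP.<-trans x<y y<a) x≮a
... | no  _   | no  _   = s≤s x<y

punchIn-cancel-< : ∀ a {x y} → punchIn a x < punchIn a y → x < y
punchIn-cancel-< a {x} {y} lt with ℕP.<-cmp x y
... | tri< x<y _ _  = x<y
... | tri≈ _ refl _ = contradiction lt (ℕP.<-irrefl refl)
... | tri> _ _ y<x  = contradiction lt (ℕP.<-asym (punchIn-mono-< a y<x))

punchIn-injective : ∀ a {x y} → punchIn a x ≡ punchIn a y → x ≡ y
punchIn-injective a {x} {y} eq with ℕP.<-cmp x y
... | tri< x<y _ _ = contradiction eq (ℕP.<⇒≢ (punchIn-mono-< a x<y))
... | tri≈ _ x≡y _ = x≡y
... | tri> _ _ y<x = contradiction (sym eq) (ℕP.<⇒≢ (punchIn-mono-< a y<x))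

≤-punchIn : ∀ a x → x ≤ punchIn a x
≤-punchIn a x with x <? a
... | yes _ = ℕP.≤-refl
... | no  _ = ℕP.n≤1+n x

punchIn-≤ : ∀ a x → punchIn a x ≤ suc x
punchIn-≤ a x with x <? a
... | yes _ = ℕP.n≤1+n x
... | no  _ = ℕP.≤-refl

≤⇔<-punchIn : ∀ a x → a ≤ x ⇔ a < punchIn a x
≤⇔<-punchIn a x = mk⇔ (λ a≤x → subst (a <_) (sym (punchIn-≥ a≤x)) (s≤s a≤x)) from
  where
  from : a < punchIn a x → a ≤ x
  from lt with x <? a
  ... | yes x<a = contradiction lt (ℕP.<-asym x<a)
  ... | no  _   = ℕP.≤-pred lt

<⇔punchIn-< : ∀ a x → x < a ⇔ punchIn a x < a
<⇔punchIn-< a x = mk⇔ (λ x<a → subst (_< a) (sym (punchIn-< x<a)) x<a) (ℕP.≤-<-trans (≤-punchIn a x))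

punchOut : ℕ → ℕ → ℕ
punchOut a x with x <? a
... | yes _ = x
... | no  _ = pred x

punchIn-punchOut : ∀ {a x} → x ≢ a → punchIn a (punchOut a x) ≡ x
punchIn-punchOut {a} {x} x≢a with x <? a
... | yes x<a = punchIn-< x<a
... | no  x≮a with ℕP.≤∧≢⇒< (ℕP.≮⇒≥ x≮a) (x≢a ∘ sym)
...   | s≤s a≤x-1 = punchIn-≥ a≤x-1

punchOut-punchIn : ∀ a y → punchOut a (punchIn a y) ≡ y
punchOut-punchIn a y with y <? a
... | yes y<a with y <? a
...   | yes _   = refl
...   | no  y≮a = contradiction y<a y≮a
punchOut-punchIn a y | no y≮a with suc y <? a
...   | yes 1+y<a = contradiction (ℕP.<-trans (ℕP.n<1+n y) 1+y<a) y≮a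
...   | no  _     = refl

module _ {f : ℕ → ℕ} (f-mono : ∀ {x y} → x < y → f x < f y) where
  mutual
    AltUp-map⁺ : ∀ xs → AltUp xs → AltUp (map f xs)
    AltUp-map⁺ []          _           = tt
    AltUp-map⁺ (x ∷ [])    _           = tt
    AltUp-map⁺ (x ∷ y ∷ r) (x<y , alt) = f-mono x<y , AltDown-map⁺ (y ∷ r) alt

    AltDown-map⁺ : ∀ xs → AltDown xs → AltDown (map f xs)
    AltDown-map⁺ []          _           = tt
    AltDown-map⁺ (x ∷ [])    _           = tt
    AltDown-map⁺ (x ∷ y ∷ r) (y<x , alt) = f-mono y<x , AltUp-map⁺ (y ∷ r) alt

module _ {f : ℕ → ℕ} (f-cancel : ∀ {x y} → f x < f y → x < y) where
  mutual
    AltUp-map⁻ : ∀ xs → AltUp (map f xs) → AltUp xs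
    AltUp-map⁻ []          _           = tt
    AltUp-map⁻ (x ∷ [])    _           = tt
    AltUp-map⁻ (x ∷ y ∷ r) (x<y , alt) = f-cancel x<y , AltDown-map⁻ (y ∷ r) alt

    AltDown-map⁻ : ∀ xs → AltDown (map f xs) → AltDown xs
    AltDown-map⁻ []          _           = tt
    AltDown-map⁻ (x ∷ [])    _           = tt
    AltDown-map⁻ (x ∷ y ∷ r) (y<x , alt) = f-cancel y<x , AltUp-map⁻ (y ∷ r) alt

FirstEntry : (ℕ → Set) → List ℕ → Set
FirstEntry P []      = ⊤
FirstEntry P (x ∷ _) = P x

-- For a permutation τ of {1, …, m}: the permutation of {1, …, m + 1} starting with a whose tail is ordered like τ
prepend : ℕ → List ℕ → List ℕ
prepend a τ = a ∷ map (punchIn a) τ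

AltUp-prepend : ∀ a τ → AltUp (prepend a τ) ⇔ (FirstEntry (a ≤_) τ × AltDown τ)
AltUp-prepend a []      = mk⇔ (λ _ → tt , tt) (λ _ → tt)
AltUp-prepend a (x ∷ τ) = mk⇔
  (λ (a<x′ , alt) → Equivalence.from (≤⇔<-punchIn a x) a<x′ , AltDown-map⁻ (punchIn-cancel-< a) (x ∷ τ) alt)
  (λ (a≤x , alt) → Equivalence.to (≤⇔<-punchIn a x) a≤x , AltDown-map⁺ (punchIn-mono-< a) (x ∷ τ) alt)

AltDown-prepend : ∀ a τ → AltDown (prepend a τ) ⇔ (FirstEntry (_< a) τ × AltUp τ)
AltDown-prepend a []      = mk⇔ (λ _ → tt , tt) (λ _ → tt)
AltDown-prepend a (x ∷ τ) = mk⇔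
  (λ (x′<a , alt) → Equivalence.from (<⇔punchIn-< a x) x′<a , AltUp-map⁻ (punchIn-cancel-< a) (x ∷ τ) alt)
  (λ (x<a , alt) → Equivalence.to (<⇔punchIn-< a x) x<a , AltUp-map⁺ (punchIn-mono-< a) (x ∷ τ) alt)

record Enumerates (n : ℕ) (σ : List ℕ) : Set where
  field
    unique   : Unique σ
    bounded  : ∀ {x} → x ∈ σ → 1 ≤ x × x ≤ n
    complete : ∀ {x} → 1 ≤ x → x ≤ n → x ∈ σ

∈-oneTo⁺ : ∀ {n x} → 1 ≤ x → x ≤ n → x ∈ oneTo n
∈-oneTo⁺ {x = suc x} _ x<n = ∈P.∈-map⁺ suc (∈P.∈-upTo⁺ x<n)

∈-oneTo⁻ : ∀ {n x} → x ∈ oneTo n → 1 ≤ x × x ≤ n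
∈-oneTo⁻ x∈ with ∈P.∈-map⁻ suc x∈
... | _ , y∈ , refl = s≤s z≤n , ∈P.∈-upTo⁻ y∈

oneTo-unique : ∀ n → Unique (oneTo n)
oneTo-unique n = UniqueP.map⁺ ℕP.suc-injective (UniqueP.upTo⁺ n)

Enumerates⇔IsPerm : ∀ n σ → Enumerates n σ ⇔ IsPerm n σ
Enumerates⇔IsPerm n σ = mk⇔ to from
  where
  to : Enumerates n σ → IsPerm n σ
  to e = ∼bag⇒↭ (unique∧set⇒bag unique (oneTo-unique n)
           (mk⇔ (λ x∈σ → ∈-oneTo⁺ (proj₁ (bounded x∈σ)) (proj₂ (bounded x∈σ)))
                (λ x∈1…n → complete (proj₁ (∈-oneTo⁻ x∈1…n)) (proj₂ (∈-oneTo⁻ x∈1…n)))))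
    where open Enumerates e
  from : IsPerm n σ → Enumerates n σ
  from σ↭1…n = record
    { unique   = ↭ₛP.Unique-resp-↭ (setoid ℕ) (↭⇒↭ₛ (↭-sym σ↭1…n)) (oneTo-unique n)
    ; bounded  = λ x∈σ → ∈-oneTo⁻ (↭P.∈-resp-↭ σ↭1…n x∈σ)
    ; complete = λ 1≤x x≤n → ↭P.∈-resp-↭ (↭-sym σ↭1…n) (∈-oneTo⁺ 1≤x x≤n)
    }

prepend-enumerates : ∀ {m a τ} → 1 ≤ a → a ≤ suc m → Enumerates m τ → Enumerates (suc m) (prepend a τ)
prepend-enumerates {m} {a} {τ} 1≤a a≤1+m e = record
  { unique   = AllP.map⁺ (All.tabulate (λ {x} _ → punchIn-≢ a x ∘ sym))
             ∷ UniqueP.map⁺ (punchIn-injective a) unique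
  ; bounded  = bounded′
  ; complete = complete′
  }
  where
  open Enumerates e
  bounded′ : ∀ {x} → x ∈ prepend a τ → 1 ≤ x × x ≤ suc m
  bounded′ (here refl) = 1≤a , a≤1+m
  bounded′ (there x∈) with ∈P.∈-map⁻ (punchIn a) x∈
  ... | y , y∈τ , refl = ℕP.≤-trans (proj₁ (bounded y∈τ)) (≤-punchIn a y)
                       , ℕP.≤-trans (punchIn-≤ a y) (s≤s (proj₂ (bounded y∈τ)))
  in-tail : ∀ {y} → 1 ≤ y → y ≤ m → punchIn a y ∈ prepend a τ
  in-tail 1≤y y≤m = there (∈P.∈-map⁺ (punchIn a) (complete 1≤y y≤m))
  complete′ : ∀ {x} → 1 ≤ x → x ≤ suc m → x ∈ prepend a τ
  complete′ {x} 1≤x x≤1+m with ℕP.<-cmp x a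
  ... | tri≈ _ refl _ = here refl
  ... | tri< x<a _ _  = subst (_∈ prepend a τ) (punchIn-< x<a) (in-tail 1≤x (ℕP.≤-pred (ℕP.<-≤-trans x<a a≤1+m)))
  complete′ {suc y} _ y<1+m | tri> _ _ (s≤s a≤y) =
    subst (_∈ prepend a τ) (punchIn-≥ a≤y) (in-tail (ℕP.≤-trans 1≤a a≤y) (ℕP.≤-pred y<1+m))

punchIn-bounded⁻ : ∀ {m a y} → 1 ≤ a → a ≤ suc m → 1 ≤ punchIn a y → punchIn a y ≤ suc m → 1 ≤ y × y ≤ m
punchIn-bounded⁻ {m} {a} {y} 1≤a a≤1+m lo hi with y <? a
... | yes y<a = lo , ℕP.≤-pred (ℕP.<-≤-trans y<a a≤1+m)
... | no  y≮a = ℕP.≤-trans 1≤a (ℕP.≮⇒≥ y≮a) , ℕP.≤-pred hi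

map-punchIn-punchOut : ∀ {a ρ} → All (a ≢_) ρ → map (punchIn a) (map (punchOut a) ρ) ≡ ρ
map-punchIn-punchOut []           = refl
map-punchIn-punchOut (a≢x ∷ a≢ρ) = cong₂ _∷_ (punchIn-punchOut (a≢x ∘ sym)) (map-punchIn-punchOut a≢ρ)

uncons-enumerates : ∀ {m a ρ} → Enumerates (suc m) (a ∷ ρ) →
  Σ (List ℕ) λ τ → a ∷ ρ ≡ prepend a τ × 1 ≤ a × a ≤ suc m × Enumerates m τ
uncons-enumerates {m} {a} {ρ} e with Enumerates.unique e
... | a∉ρ ∷ ρ-unique = map (punchOut a) ρ , cong (a ∷_) (sym ρ≡) , 1≤a , a≤1+m , record
  { unique   = UniqueP.map⁻ (subst Unique (sym ρ≡) ρ-unique)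
  ; bounded  = bounded′
  ; complete = complete′
  }
  where
  open Enumerates e
  ρ≡ = map-punchIn-punchOut a∉ρ
  1≤a    = proj₁ (bounded (here refl))
  a≤1+m  = proj₂ (bounded (here refl))
  bounded′ : ∀ {y} → y ∈ map (punchOut a) ρ → 1 ≤ y × y ≤ m
  bounded′ y∈ with ∈P.∈-map⁻ (punchOut a) y∈
  ... | x , x∈ρ , refl = punchIn-bounded⁻ 1≤a a≤1+m (subst (1 ≤_) (sym x≡) (proj₁ (bounded (there x∈ρ))))
                                                  (subst (_≤ suc m) (sym x≡) (proj₂ (bounded (there x∈ρ))))
    where x≡ = punchIn-punchOut (All.lookup a∉ρ x∈ρ ∘ sym)
  complete′ : ∀ {y} → 1 ≤ y → y ≤ m → y ∈ map (punchOut a) ρ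
  complete′ {y} 1≤y y≤m with complete (ℕP.≤-trans 1≤y (≤-punchIn a y)) (ℕP.≤-trans (punchIn-≤ a y) (s≤s y≤m))
  ... | here eq   = contradiction eq (punchIn-≢ a y)
  ... | there x∈ρ = subst (_∈ map (punchOut a) ρ) (punchOut-punchIn a y) (∈P.∈-map⁺ (punchOut a) x∈ρ)

prependAll : ℕ → List (List ℕ) → List (List ℕ)
prependAll zero    τs = []
prependAll (suc k) τs = prependAll k τs ++ map (prepend (suc k)) τs

perms : ℕ → List (List ℕ)
perms zero    = [] ∷ []
perms (suc m) = prependAll (suc m) (perms m)

∈-prependAll⁻ : ∀ k τs {σ} → σ ∈ prependAll k τs → ∃ λ t → t < k × ∃ λ τ → τ ∈ τs × σ ≡ prepend (suc t) τ
∈-prependAll⁻ (suc k) τs σ∈ with ∈P.∈-++⁻ (prependAll k τs) σ∈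
... | inj₁ σ∈′ with ∈-prependAll⁻ k τs σ∈′
...   | t , t<k , rest = t , ℕP.m<n⇒m<1+n t<k , rest
∈-prependAll⁻ (suc k) τs σ∈ | inj₂ σ∈′ with ∈P.∈-map⁻ (prepend (suc k)) σ∈′
... | τ , τ∈ , eq = k , ℕP.≤-refl , τ , τ∈ , eq

∈-prependAll⁺ : ∀ k τs {t τ} → t < k → τ ∈ τs → prepend (suc t) τ ∈ prependAll k τs
∈-prependAll⁺ (suc k) τs {t} t<1+k τ∈ with ℕP.m<1+n⇒m<n∨m≡n t<1+k
... | inj₁ t<k  = ∈P.∈-++⁺ˡ (∈-prependAll⁺ k τs t<k τ∈)
... | inj₂ refl = ∈P.∈-++⁺ʳ (prependAll k τs) (∈P.∈-map⁺ (prepend (suc t)) τ∈)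

prependAll-unique : ∀ k {τs} → Unique τs → Unique (prependAll k τs)
prependAll-unique zero         _         = []
prependAll-unique (suc k) {τs} τs-unique =
  UniqueP.++⁺ (prependAll-unique k τs-unique) (UniqueP.map⁺ prepend-injective τs-unique) disjoint
  where
  prepend-injective : ∀ {τ τ′} → prepend (suc k) τ ≡ prepend (suc k) τ′ → τ ≡ τ′
  prepend-injective eq = ListP.map-injective (punchIn-injective (suc k)) (ListP.∷-injectiveʳ eq)
  disjoint : ∀ {σ} → ¬ (σ ∈ prependAll k τs × σ ∈ map (prepend (suc k)) τs)
  disjoint (σ∈ , σ∈′) with ∈-prependAll⁻ k τs σ∈ | ∈P.∈-map⁻ (prepend (suc k)) σ∈′
  ... | t , t<k , _ , _ , refl | _ , _ , eq = ℕP.<-irrefl (ℕP.suc-injective (ListP.∷-injectiveˡ eq)) t<k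

perms-unique : ∀ n → Unique (perms n)
perms-unique zero    = [] ∷ []
perms-unique (suc m) = prependAll-unique (suc m) (perms-unique m)

∈-perms⇒ : ∀ n {σ} → σ ∈ perms n → Enumerates n σ
∈-perms⇒ zero    (here refl) = record
  { unique   = []
  ; bounded  = λ ()
  ; complete = λ 1≤x x≤0 → contradiction (ℕP.≤-trans 1≤x x≤0) λ ()
  }
∈-perms⇒ (suc m) σ∈ with ∈-prependAll⁻ (suc m) (perms m) σ∈
... | t , t<1+m , τ , τ∈ , refl = prepend-enumerates (s≤s z≤n) t<1+m (∈-perms⇒ m τ∈)

∈-perms⇐ : ∀ n {σ} → Enumerates n σ → σ ∈ perms n
∈-perms⇐ zero    {[]}    _ = here refl
∈-perms⇐ zero    {x ∷ _} e = contradiction (ℕP.≤-trans (proj₁ x-bounds) (proj₂ x-bounds)) λ ()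
  where x-bounds = Enumerates.bounded e (here refl)
∈-perms⇐ (suc m) {[]}    e with Enumerates.complete e {1} ℕP.≤-refl (s≤s z≤n)
... | ()
∈-perms⇐ (suc m) {a ∷ ρ} e with uncons-enumerates e
... | τ , eq , s≤s z≤n , a≤1+m , e′ =
  subst (_∈ perms (suc m)) (sym eq) (∈-prependAll⁺ (suc m) (perms m) a≤1+m (∈-perms⇐ m e′))

∈-perms⇔IsPerm : ∀ n σ → σ ∈ perms n ⇔ IsPerm n σ
∈-perms⇔IsPerm n σ = Enumerates⇔IsPerm n σ ⇔-∘ mk⇔ (∈-perms⇒ n) (∈-perms⇐ n)

count : ∀ {A : Set} {P : Pred A 0ℓ} → Decidable P → List A → ℕ
count P? xs = length (filter P? xs)

module _ {A : Set} {P : Pred A 0ℓ} (P? : Decidable P) where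

  count-++ : ∀ xs ys → count P? (xs ++ ys) ≡ count P? xs ℕ.+ count P? ys
  count-++ xs ys = trans (cong length (ListP.filter-++ P? xs ys)) (ListP.length-++ (filter P? xs))

  count-none : ∀ {xs} → (∀ {x} → x ∈ xs → ¬ P x) → count P? xs ≡ 0
  count-none ¬P = cong length (ListP.filter-none P? (All.tabulate ¬P))

  count-map : ∀ {B : Set} (f : B → A) xs → count P? (map f xs) ≡ count (P? ∘ f) xs
  count-map f []       = refl
  count-map f (x ∷ xs) with P? (f x)
  ... | yes _ = cong suc (count-map f xs)
  ... | no  _ = count-map f xs

  count-cong : ∀ {Q : Pred A 0ℓ} (Q? : Decidable Q) xs → (∀ {x} → x ∈ xs → P x ⇔ Q x) → count P? xs ≡ count Q? xs
  count-cong Q? []       _   = refl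
  count-cong Q? (x ∷ xs) P⇔Q with P? x | Q? x
  ... | yes _  | yes _  = cong suc (count-cong Q? xs (P⇔Q ∘ there))
  ... | no  _  | no  _  = count-cong Q? xs (P⇔Q ∘ there)
  ... | yes px | no ¬qx = contradiction (Equivalence.to (P⇔Q (here refl)) px) ¬qx
  ... | no ¬px | yes qx = contradiction (Equivalence.from (P⇔Q (here refl)) qx) ¬px

when : ∀ {C : Set} → Dec C → ℕ → ℕ
when (yes _) n = n
when (no  _) _ = 0

when-cong : ∀ {C C′ : Set} (C? : Dec C) (C′? : Dec C′) n → C ⇔ C′ → when C? n ≡ when C′? n
when-cong (yes _) (yes _)  n _    = refl
when-cong (no  _) (no  _)  n _    = refl
when-cong (yes c) (no ¬c′) n C⇔C′ = contradiction (Equivalence.to C⇔C′ c) ¬c′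
when-cong (no ¬c) (yes c′) n C⇔C′ = contradiction (Equivalence.from C⇔C′ c′) ¬c

count-when : ∀ {A : Set} {P Q : Pred A 0ℓ} {C : Set} (P? : Decidable P) (Q? : Decidable Q) (C? : Dec C) xs →
  (∀ {x} → x ∈ xs → P x ⇔ (C × Q x)) → count P? xs ≡ when C? (count Q? xs)
count-when P? Q? (yes c) xs P⇔ =
  count-cong P? Q? xs (λ x∈ → mk⇔ (proj₂ ∘ Equivalence.to (P⇔ x∈)) (λ q → Equivalence.from (P⇔ x∈) (c , q)))
count-when P? Q? (no ¬c) xs P⇔ = count-none P? (λ x∈ p → ¬c (proj₁ (Equivalence.to (P⇔ x∈) p)))

∑-when-< : ∀ {a n} (f : ℕ → ℕ) → a ≤ n → ℕ∑.∑ n (λ t → when (t <? a) (f t)) ≡ ℕ∑.∑ a f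
∑-when-< {a} {n} f a≤n with ℕP.m≤n⇒m<n∨m≡n a≤n
... | inj₂ refl = ℕ∑.∑-cong a (λ t t<a → when-cong (t <? a) (yes t<a) (f t) (⇔-id _))
∑-when-< {a} {suc n} f _ | inj₁ (s≤s a≤n) =
  trans (cong₂ ℕ._+_ (∑-when-< f a≤n) (when-cong (n <? a) (no (ℕP.≤⇒≯ a≤n)) (f n) (⇔-id _))) (ℕP.+-identityʳ _)

∑-when-≥ : ∀ {a n} (f : ℕ → ℕ) → a ≤ n → ℕ∑.∑ n (λ t → when (a ≤? t) (f t)) ≡ ℕ∑.∑ (n ∸ a) (λ j → f (n ∸ suc j))
∑-when-≥ {a} {n} f a≤n with ℕP.m≤n⇒m<n∨m≡n a≤n
... | inj₂ refl = trans (ℕ∑.∑-zero a (λ t t<a → when-cong (a ≤? t) (no (ℕP.<⇒≱ t<a)) (f t) (⇔-id _)))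
                        (cong (λ k → ℕ∑.∑ k (λ j → f (a ∸ suc j))) (sym (ℕP.n∸n≡0 a)))
∑-when-≥ {a} {suc n} f _ | inj₁ (s≤s a≤n) = begin
  ℕ∑.∑ n (λ t → when (a ≤? t) (f t)) ℕ.+ when (a ≤? n) (f n)
    ≡⟨ cong₂ ℕ._+_ (∑-when-≥ f a≤n) (when-cong (a ≤? n) (yes a≤n) (f n) (⇔-id _)) ⟩
  ℕ∑.∑ (n ∸ a) (λ j → f (n ∸ suc j)) ℕ.+ f n
    ≡⟨ ℕP.+-comm _ (f n) ⟩
  f n ℕ.+ ℕ∑.∑ (n ∸ a) (λ j → f (n ∸ suc j))
    ≡⟨ ℕ∑.∑-head (n ∸ a) (λ j → f (n ∸ j)) ⟨
  ℕ∑.∑ (suc (n ∸ a)) (λ j → f (n ∸ j))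
    ≡⟨ cong (λ k → ℕ∑.∑ k (λ j → f (suc n ∸ suc j))) (ℕP.+-∸-assoc 1 a≤n) ⟨
  ℕ∑.∑ (suc n ∸ a) (λ j → f (suc n ∸ suc j)) ∎
  where open ≡-Reasoning

∑-const : ∀ n c → ℕ∑.∑ n (λ _ → c) ≡ n ℕ.* c
∑-const zero    c = refl
∑-const (suc n) c = trans (cong (ℕ._+ c) (∑-const n c)) (ℕP.+-comm (n ℕ.* c) c)

count-prependAll : ∀ {P : Pred (List ℕ) 0ℓ} (P? : Decidable P) k τs →
  count P? (prependAll k τs) ≡ ℕ∑.∑ k (λ t → count (P? ∘ prepend (suc t)) τs)
count-prependAll P? zero    τs = refl
count-prependAll P? (suc k) τs = trans (count-++ P? (prependAll k τs) _)
  (cong₂ ℕ._+_ (count-prependAll P? k τs) (count-map P? (prepend (suc k)) τs))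

count-perms₂ : ∀ {P : Pred (List ℕ) 0ℓ} (P? : Decidable P) k →
  count P? (perms (suc (suc k))) ≡
  ℕ∑.∑ (suc (suc k)) (λ a → ℕ∑.∑ (suc k) (λ b → count (P? ∘ prepend (suc a) ∘ prepend (suc b)) (perms k)))
count-perms₂ P? k = trans (count-prependAll P? (suc (suc k)) (perms (suc k)))
  (ℕ∑.∑-cong (suc (suc k)) (λ a _ → count-prependAll (P? ∘ prepend (suc a)) (suc k) (perms k)))

-- Alternating permutations

mutual
  AltUp? : Decidable AltUp
  AltUp? []          = yes tt
  AltUp? (a ∷ [])    = yes tt
  AltUp? (a ∷ b ∷ r) = (a <? b) ×-dec AltDown? (b ∷ r)

  AltDown? : Decidable AltDown
  AltDown? []          = yes tt
  AltDown? (a ∷ [])    = yes tt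
  AltDown? (a ∷ b ∷ r) = (b <? a) ×-dec AltUp? (b ∷ r)

FirstEntry? : ∀ {P : Pred ℕ 0ℓ} → Decidable P → Decidable (FirstEntry P)
FirstEntry? P? []      = yes tt
FirstEntry? P? (x ∷ _) = P? x

PeakCond? : Decidable PeakCond
PeakCond? []              = no λ ()
PeakCond? (_ ∷ [])        = no λ ()
PeakCond? (_ ∷ _ ∷ [])    = no λ ()
PeakCond? (a ∷ b ∷ c ∷ _) = suc (a ⊔ c) <? b

upDownBelow : ℕ → ℕ → ℕ
upDownBelow m a = count (λ τ → FirstEntry? (_<? a) τ ×-dec AltUp? τ) (perms m)

downUpFrom : ℕ → ℕ → ℕ
downUpFrom m a = count (λ τ → FirstEntry? (a ≤?_) τ ×-dec AltDown? τ) (perms m)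

upDownBelow-suc : ∀ m a → upDownBelow (suc m) a ≡ ℕ∑.∑ (suc m) (λ t → when (suc t <? a) (downUpFrom m (suc t)))
upDownBelow-suc m a = trans (count-prependAll _ (suc m) (perms m))
  (ℕ∑.∑-cong (suc m) (λ t _ → count-when _ _ (suc t <? a) (perms m) (λ {τ} _ → ⇔-id _ ×-⇔ AltUp-prepend (suc t) τ)))

downUpFrom-suc : ∀ m a → downUpFrom (suc m) a ≡ ℕ∑.∑ (suc m) (λ t → when (a ≤? suc t) (upDownBelow m (suc t)))
downUpFrom-suc m a = trans (count-prependAll _ (suc m) (perms m))
  (ℕ∑.∑-cong (suc m) (λ t _ → count-when _ _ (a ≤? suc t) (perms m) (λ {τ} _ → ⇔-id _ ×-⇔ AltDown-prepend (suc t) τ)))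

s≤s-⇔ : ∀ {m n} → m ≤ n ⇔ suc m ≤ suc n
s≤s-⇔ = mk⇔ s≤s ℕP.≤-pred

mutual
  upDownBelow≡entringer : ∀ {m a} → a ≤ m → ℕtoℚ (upDownBelow m (suc a)) ≡ entringer m a
  upDownBelow≡entringer {zero}  z≤n = refl
  upDownBelow≡entringer {suc m} {a} a≤1+m = begin
    ℕtoℚ (upDownBelow (suc m) (suc a))
      ≡⟨ cong ℕtoℚ (upDownBelow-suc m (suc a)) ⟩
    ℕtoℚ (ℕ∑.∑ (suc m) (λ t → when (suc t <? suc a) (downUpFrom m (suc t))))
      ≡⟨ cong ℕtoℚ (ℕ∑.∑-cong (suc m) (λ t _ → when-cong (suc t <? suc a) (t <? a) _ (⇔-sym s≤s-⇔))) ⟩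
    ℕtoℚ (ℕ∑.∑ (suc m) (λ t → when (t <? a) (downUpFrom m (suc t))))
      ≡⟨ cong ℕtoℚ (∑-when-< (λ t → downUpFrom m (suc t)) a≤1+m) ⟩
    ℕtoℚ (ℕ∑.∑ a (λ t → downUpFrom m (suc t)))
      ≡⟨ ℕtoℚ-∑ a _ ⟩
    ℚ∑.∑ a (λ t → ℕtoℚ (downUpFrom m (suc t)))
      ≡⟨ ℚ∑.∑-cong a (λ t t<a → downUpFrom≡entringer (ℕP.≤-pred (ℕP.<-≤-trans t<a a≤1+m))) ⟩
    ℚ∑.∑ a (λ t → entringer m (m ∸ t))
      ≡⟨ entringer-suc-∑ a≤1+m ⟨
    entringer (suc m) a ∎
    where open ≡-Reasoning

  downUpFrom≡entringer : ∀ {m a} → a ≤ m → ℕtoℚ (downUpFrom m (suc a)) ≡ entringer m (m ∸ a)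
  downUpFrom≡entringer {zero}  z≤n = refl
  downUpFrom≡entringer {suc m} {a} a≤1+m = begin
    ℕtoℚ (downUpFrom (suc m) (suc a))
      ≡⟨ cong ℕtoℚ (downUpFrom-suc m (suc a)) ⟩
    ℕtoℚ (ℕ∑.∑ (suc m) (λ t → when (suc a ≤? suc t) (upDownBelow m (suc t))))
      ≡⟨ cong ℕtoℚ (ℕ∑.∑-cong (suc m) (λ t _ → when-cong (suc a ≤? suc t) (a ≤? t) _ (⇔-sym s≤s-⇔))) ⟩
    ℕtoℚ (ℕ∑.∑ (suc m) (λ t → when (a ≤? t) (upDownBelow m (suc t))))
      ≡⟨ cong ℕtoℚ (∑-when-≥ (λ t → upDownBelow m (suc t)) a≤1+m) ⟩
    ℕtoℚ (ℕ∑.∑ (suc m ∸ a) (λ j → upDownBelow m (suc (m ∸ j))))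
      ≡⟨ ℕtoℚ-∑ (suc m ∸ a) _ ⟩
    ℚ∑.∑ (suc m ∸ a) (λ j → ℕtoℚ (upDownBelow m (suc (m ∸ j))))
      ≡⟨ ℚ∑.∑-cong (suc m ∸ a) (λ j _ → upDownBelow≡entringer (ℕP.m∸n≤m m j)) ⟩
    ℚ∑.∑ (suc m ∸ a) (λ j → entringer m (m ∸ j))
      ≡⟨ entringer-suc-∑ (ℕP.m∸n≤m (suc m) a) ⟨
    entringer (suc m) (suc m ∸ a) ∎
    where open ≡-Reasoning

count-AltUp≡upDownBelow : ∀ n → count AltUp? (perms n) ≡ upDownBelow n (suc n)
count-AltUp≡upDownBelow n = count-cong AltUp? _ (perms n) first-entry-bounded
  where
  first-entry-bounded : ∀ {σ} → σ ∈ perms n → AltUp σ ⇔ (FirstEntry (_< suc n) σ × AltUp σ)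
  first-entry-bounded {[]}    _  = mk⇔ (tt ,_) proj₂
  first-entry-bounded {x ∷ σ} σ∈ = mk⇔ (s≤s (proj₂ (Enumerates.bounded (∈-perms⇒ n σ∈) (here refl))) ,_) proj₂

andré : ∀ n → ℕtoℚ (count AltUp? (perms n)) ≡ ℕtoℚ (n !) * (secPS n + tanPS n)
andré n = trans (cong ℕtoℚ (count-AltUp≡upDownBelow n)) (trans (upDownBelow≡entringer {n} ℕP.≤-refl) (entringer-diag n))

AltUp-prepend₂ : ∀ a b μ → AltUp (prepend a (prepend b μ)) ⇔ (a ≤ b × FirstEntry (_< b) μ × AltUp μ)
AltUp-prepend₂ a b μ = (⇔-id _ ×-⇔ AltDown-prepend b μ) ⇔-∘ AltUp-prepend a (prepend b μ)

AltUpPeak : List ℕ → Set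
AltUpPeak σ = AltUp σ × PeakCond σ

AltUpPeak? : Decidable AltUpPeak
AltUpPeak? σ = AltUp? σ ×-dec PeakCond? σ

AltUpPeak-prepend₂ : ∀ a b h μ → AltUpPeak (prepend a (prepend b (h ∷ μ))) ⇔ (a < b × suc h < b × AltUp (h ∷ μ))
AltUpPeak-prepend₂ a b h μ = mk⇔ to from
  where
  to : AltUpPeak (prepend a (prepend b (h ∷ μ))) → a < b × suc h < b × AltUp (h ∷ μ)
  to (alt , peak) with Equivalence.to (AltUp-prepend₂ a b (h ∷ μ)) alt
  ... | a≤b , h<b , alt-μ = a<b , 1+h<b , alt-μ
    where
    a⊔h′<b : a ⊔ punchIn a h < b
    a⊔h′<b = ℕP.≤-pred (subst₂ (λ x y → suc (a ⊔ punchIn a x) < y) (punchIn-< h<b) (punchIn-≥ a≤b) peak)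
    a<b : a < b
    a<b = ℕP.≤-<-trans (ℕP.m≤m⊔n a _) a⊔h′<b
    1+h<b : suc h < b
    1+h<b with h <? a
    ... | yes h<a = ℕP.≤-<-trans h<a a<b
    ... | no  h≮a = subst (_< b) (punchIn-≥ (ℕP.≮⇒≥ h≮a)) (ℕP.≤-<-trans (ℕP.m≤n⊔m a _) a⊔h′<b)
  from : a < b × suc h < b × AltUp (h ∷ μ) → AltUpPeak (prepend a (prepend b (h ∷ μ)))
  from (a<b , 1+h<b , alt-μ) = Equivalence.from (AltUp-prepend₂ a b (h ∷ μ)) (ℕP.<⇒≤ a<b , h<b , alt-μ) , peak
    where
    h<b = ℕP.<-trans (ℕP.n<1+n h) 1+h<b
    peak : suc (a ⊔ punchIn a (punchIn b h)) < punchIn a b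
    peak = subst₂ (λ x y → suc (a ⊔ punchIn a x) < y) (sym (punchIn-< h<b)) (sym (punchIn-≥ (ℕP.<⇒≤ a<b)))
             (s≤s (ℕP.⊔-lub a<b (ℕP.≤-<-trans (punchIn-≤ a h) 1+h<b)))

∑-when-<-const : ∀ {b n} c → b ≤ n → ℕ∑.∑ n (λ a → when (a <? b) c) ≡ b ℕ.* c
∑-when-<-const {b} c b≤n = trans (∑-when-< (λ _ → c) b≤n) (∑-const b c)

count-AltUp-perms₂ : ∀ k → count AltUp? (perms (suc (suc k))) ≡ ℕ∑.∑ (suc k) (λ b → suc b ℕ.* upDownBelow k (suc b))
count-AltUp-perms₂ k = begin
  count AltUp? (perms (suc (suc k)))
    ≡⟨ count-perms₂ AltUp? k ⟩
  ℕ∑.∑ (suc (suc k)) (λ a → ℕ∑.∑ (suc k) (λ b → count (AltUp? ∘ prepend (suc a) ∘ prepend (suc b)) (perms k)))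
    ≡⟨ ℕ∑.∑-cong (suc (suc k)) (λ a _ → ℕ∑.∑-cong (suc k) (λ b _ →
         count-when _ _ (a <? suc b) (perms k) (λ {μ} _ → AltUp-prepend₂ (suc a) (suc b) μ))) ⟩
  ℕ∑.∑ (suc (suc k)) (λ a → ℕ∑.∑ (suc k) (λ b → when (a <? suc b) (upDownBelow k (suc b))))
    ≡⟨ ℕ∑.∑-comm (suc (suc k)) (suc k) _ ⟩
  ℕ∑.∑ (suc k) (λ b → ℕ∑.∑ (suc (suc k)) (λ a → when (a <? suc b) (upDownBelow k (suc b))))
    ≡⟨ ℕ∑.∑-cong (suc k) (λ b b<1+k → ∑-when-<-const _ (ℕP.m<n⇒m<1+n b<1+k)) ⟩
  ℕ∑.∑ (suc k) (λ b → suc b ℕ.* upDownBelow k (suc b)) ∎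
  where open ≡-Reasoning

count-AltUpPeak-perms₃ : ∀ m → count AltUpPeak? (perms (3 ℕ.+ m)) ≡ ℕ∑.∑ (2 ℕ.+ m) (λ b → b ℕ.* upDownBelow (suc m) b)
count-AltUpPeak-perms₃ m = begin
  count AltUpPeak? (perms (3 ℕ.+ m))
    ≡⟨ count-perms₂ AltUpPeak? (suc m) ⟩
  ℕ∑.∑ (3 ℕ.+ m) (λ a → ℕ∑.∑ (2 ℕ.+ m) (λ b → count (AltUpPeak? ∘ prepend (suc a) ∘ prepend (suc b)) (perms (suc m))))
    ≡⟨ ℕ∑.∑-cong (3 ℕ.+ m) (λ a _ → ℕ∑.∑-cong (2 ℕ.+ m) (λ b _ → count-when _ _ (a <? b) (perms (suc m)) (AltUpPeak-⇔ a b))) ⟩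
  ℕ∑.∑ (3 ℕ.+ m) (λ a → ℕ∑.∑ (2 ℕ.+ m) (λ b → when (a <? b) (upDownBelow (suc m) b)))
    ≡⟨ ℕ∑.∑-comm (3 ℕ.+ m) (2 ℕ.+ m) _ ⟩
  ℕ∑.∑ (2 ℕ.+ m) (λ b → ℕ∑.∑ (3 ℕ.+ m) (λ a → when (a <? b) (upDownBelow (suc m) b)))
    ≡⟨ ℕ∑.∑-cong (2 ℕ.+ m) (λ b b<2+m → ∑-when-<-const _ (ℕP.<⇒≤ (ℕP.m<n⇒m<1+n b<2+m))) ⟩
  ℕ∑.∑ (2 ℕ.+ m) (λ b → b ℕ.* upDownBelow (suc m) b) ∎
  where
  open ≡-Reasoning
  AltUpPeak-⇔ : ∀ a b {μ} → μ ∈ perms (suc m) →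
    AltUpPeak (prepend (suc a) (prepend (suc b) μ)) ⇔ (a < b × FirstEntry (_< b) μ × AltUp μ)
  AltUpPeak-⇔ a b {[]}    μ∈ = contradiction (Enumerates.complete (∈-perms⇒ (suc m) μ∈) ℕP.≤-refl (s≤s z≤n)) λ ()
  AltUpPeak-⇔ a b {h ∷ μ} _  = (⇔-sym s≤s-⇔ ×-⇔ ⇔-sym s≤s-⇔ ×-⇔ ⇔-id _) ⇔-∘ AltUpPeak-prepend₂ (suc a) (suc b) h μ

count-AltUp≡count-AltUpPeak+ : ∀ m →
  count AltUp? (perms (3 ℕ.+ m)) ≡ count AltUpPeak? (perms (3 ℕ.+ m)) ℕ.+ (2 ℕ.+ m) ℕ.* count AltUp? (perms (suc m))
count-AltUp≡count-AltUpPeak+ m = begin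
  count AltUp? (perms (3 ℕ.+ m))                                ≡⟨ count-AltUp-perms₂ (suc m) ⟩
  ℕ∑.∑ (2 ℕ.+ m) (λ b → suc b ℕ.* upDownBelow (suc m) (suc b))  ≡⟨ ℕ∑.∑-head (2 ℕ.+ m) weighted ⟨
  ℕ∑.∑ (2 ℕ.+ m) weighted ℕ.+ weighted (2 ℕ.+ m)
    ≡⟨ cong₂ ℕ._+_ (count-AltUpPeak-perms₃ m) (cong ((2 ℕ.+ m) ℕ.*_) (count-AltUp≡upDownBelow (suc m))) ⟨
  count AltUpPeak? (perms (3 ℕ.+ m)) ℕ.+ (2 ℕ.+ m) ℕ.* count AltUp? (perms (suc m)) ∎
  where
  open ≡-Reasoning
  weighted : ℕ → ℕ
  weighted b = b ℕ.* upDownBelow (suc m) b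

count-AltUpPeak : ∀ m → ℕtoℚ (count AltUpPeak? (perms (3 ℕ.+ m))) ≡
  ℕtoℚ ((3 ℕ.+ m) !) * (secPS ⊕ tanPS) (3 ℕ.+ m) - ℕtoℚ (2 ℕ.+ m) * (ℕtoℚ ((1 ℕ.+ m) !) * (secPS ⊕ tanPS) (1 ℕ.+ m))
count-AltUpPeak m = begin
  peak                                     ≡⟨ solve 2 (λ p r → p := p :+ r :- r) refl peak rest ⟩
  peak + rest - rest                       ≡⟨ cong (_- rest) ℕtoℚ-count-AltUp ⟨
  ℕtoℚ (count AltUp? (perms (3 ℕ.+ m))) - rest
    ≡⟨ cong₂ _-_ (andré (3 ℕ.+ m)) (cong (ℕtoℚ (2 ℕ.+ m) *_) (andré (suc m))) ⟩
  ℕtoℚ ((3 ℕ.+ m) !) * (secPS ⊕ tanPS) (3 ℕ.+ m) - ℕtoℚ (2 ℕ.+ m) * (ℕtoℚ ((1 ℕ.+ m) !) * (secPS ⊕ tanPS) (1 ℕ.+ m)) ∎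
  where
  open ≡-Reasoning
  open +-*-Solver
  peak = ℕtoℚ (count AltUpPeak? (perms (3 ℕ.+ m)))
  rest = ℕtoℚ (2 ℕ.+ m) * ℕtoℚ (count AltUp? (perms (suc m)))
  ℕtoℚ-count-AltUp : ℕtoℚ (count AltUp? (perms (3 ℕ.+ m))) ≡ peak + rest
  ℕtoℚ-count-AltUp = begin
    ℕtoℚ (count AltUp? (perms (3 ℕ.+ m)))                     ≡⟨ cong ℕtoℚ (count-AltUp≡count-AltUpPeak+ m) ⟩
    ℕtoℚ (count AltUpPeak? (perms (3 ℕ.+ m)) ℕ.+ (2 ℕ.+ m) ℕ.* count AltUp? (perms (suc m)))
      ≡⟨ ℕtoℚ-+ (count AltUpPeak? (perms (3 ℕ.+ m))) _ ⟩
    peak + ℕtoℚ ((2 ℕ.+ m) ℕ.* count AltUp? (perms (suc m)))  ≡⟨ cong (_+_ peak) (ℕtoℚ-* (2 ℕ.+ m) (count AltUp? (perms (suc m)))) ⟩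
    peak + rest                                              ∎

factorial-*-targetPS : ∀ m → ℕtoℚ ((3 ℕ.+ m) !) * targetPS (3 ℕ.+ m) ≡
  ℕtoℚ ((3 ℕ.+ m) !) * (secPS ⊕ tanPS) (3 ℕ.+ m) - ℕtoℚ (2 ℕ.+ m) * (ℕtoℚ ((1 ℕ.+ m) !) * (secPS ⊕ tanPS) (1 ℕ.+ m))
factorial-*-targetPS m = begin
  ℕtoℚ ((3 ℕ.+ m) !) * (S₃ - S₁ * q)              ≡⟨ cong (_* (S₃ - S₁ * q)) n!≡ ⟩
  n * (n-1 * f) * (S₃ - S₁ * q)                   ≡⟨ solve 6 (λ n n-1 f S₃ S₁ q →
                                                       n :* (n-1 :* f) :* (S₃ :- S₁ :* q) :=
                                                       n :* (n-1 :* f) :* S₃ :- n-1 :* (f :* S₁) :* (n :* q))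
                                                     refl n n-1 f S₃ S₁ q ⟩
  n * (n-1 * f) * S₃ - n-1 * (f * S₁) * (n * q)   ≡⟨ cong (λ x → n * (n-1 * f) * S₃ - n-1 * (f * S₁) * x) (ℕtoℚ-*-inverse (3 ℕ.+ m)) ⟩
  n * (n-1 * f) * S₃ - n-1 * (f * S₁) * 1ℚ        ≡⟨ cong (λ x → n * (n-1 * f) * S₃ - x) (ℚP.*-identityʳ _) ⟩
  n * (n-1 * f) * S₃ - n-1 * (f * S₁)             ≡⟨ cong (λ x → x * S₃ - n-1 * (f * S₁)) n!≡ ⟨
  ℕtoℚ ((3 ℕ.+ m) !) * S₃ - n-1 * (f * S₁)        ∎
  where
  open ≡-Reasoning
  open +-*-Solver
  n   = ℕtoℚ (3 ℕ.+ m)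
  n-1 = ℕtoℚ (2 ℕ.+ m)
  f   = ℕtoℚ ((1 ℕ.+ m) !)
  S₃  = (secPS ⊕ tanPS) (3 ℕ.+ m)
  S₁  = (secPS ⊕ tanPS) (1 ℕ.+ m)
  q   = + 1 ℚ./ (3 ℕ.+ m)
  n!≡ : ℕtoℚ ((3 ℕ.+ m) !) ≡ n * (n-1 * f)
  n!≡ = trans (ℕtoℚ-* (3 ℕ.+ m) ((2 ℕ.+ m) !)) (cong (n *_) (ℕtoℚ-* (2 ℕ.+ m) ((1 ℕ.+ m) !)))

mainTheorem8 : (n : ℕ) → 3 ≤ n →
    Σ (List (List ℕ)) (λ L →
      Unique L × ((σ : List ℕ) → (σ ∈ L) ⇔ Good n σ) ×
      (ℕtoℚ (length L) ≡ ℕtoℚ (n !) * targetPS n))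
mainTheorem8 (suc (suc (suc m))) (s≤s (s≤s (s≤s _))) =
  filter AltUpPeak? (perms n) ,
  UniqueP.filter⁺ AltUpPeak? (perms-unique n) ,
  ∈⇔Good ,
  trans (count-AltUpPeak m) (sym (factorial-*-targetPS m))
  where
  n = 3 ℕ.+ m
  ∈⇔Good : ∀ σ → σ ∈ filter AltUpPeak? (perms n) ⇔ Good n σ
  ∈⇔Good σ = mk⇔
    (λ σ∈ → let (σ∈perms , alt , peak) = ∈P.∈-filter⁻ AltUpPeak? σ∈
            in (Equivalence.to (∈-perms⇔IsPerm n σ) σ∈perms , alt) , peak)
    (λ ((σ-perm , alt) , peak) → ∈P.∈-filter⁺ AltUpPeak? (Equivalence.from (∈-perms⇔IsPerm n σ) σ-perm) (alt , peak))
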